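{- Let $a>1$ be an integer. Then $$\{n\in\mathbb N: n\mid a^n\}=\{n\in\mathbb N: n^2\mid a^n\}=\mathcal F_a,$$ and for every integer $j\ge 3$ the set $\{n\in\mathbb N: n^j\mid a^n\}$ equals $\mathcal F_a\setminus S^{(j)}_a$ for some finite set $S^{(j)}_a$.
   Context: For an integer $a>1$, $\mathcal F_a$ is the set of all positive integers all of whose prime factors divide $a$ (including $1$). -}

module Defs where

open import Data.Nat using (ℕ; _≤_; _<_)
open import Data.Nat.Divisibility using (_∣_)
open import Data.Nat.Primality using (Prime)
open import Data.Product using (_×_)

𝓕 : ℕ → ℕ → Set
𝓕 a n = 1 ≤ n × (∀ p → Prime p → p ∣ n → p ∣ a)

module Submission where

-- If n ∈ 𝓕_a, write n = p₁ ⋯ p_k as a product of k primes, each dividing a.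
-- Then n ∣ a^k, and 2^k ≤ n because every prime is at least 2.  Consequently
-- n^j ∣ a^(jk), which divides a^n as soon as j·k ≤ n.  Since 2^k ≤ n, this
-- "exponent bound" holds for every n when j ≤ 2 (because 2k ≤ 2^k), and for
-- all n ≥ j(j+4) when j is arbitrary (because k² ≤ 2^k for k ≥ 4).
-- Conversely, n^j ∣ a^n with j ≥ 1 forces n ≥ 1 and makes every prime factor
-- of n divide a, i.e. n ∈ 𝓕_a.
--
-- The theorem follows by combining them.

open import Defs
open import Data.Nat using (ℕ; _≤_; _<_; _^_)
open import Data.Nat.Divisibility using (_∣_)
open import Data.Product using (_×_; Σ)
open import Data.List using (List)
open import Data.List.Membership.Propositional using (_∉_)
open import Function.Bundles using (_⇔_)

open import Data.Nat using (zero; suc; _+_; _*_; _∸_; z≤n; s≤s; >-nonZero; nonTrivial⇒n>1)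
open import Data.Nat.Properties
open import Data.Nat.Divisibility
  using (_∣?_; ∣-trans; ∣-refl; *-pres-∣; m∣m*n; ∣1⇒≡1; 0∣⇒≡0; module ∣-Reasoning)
open import Data.Nat.Primality using (Prime; euclidsLemma; ¬prime[1]; prime⇒nonTrivial)
open import Data.Nat.Primality.Factorisation using (factorise; PrimeFactorisation)
open import Data.Nat.ListAction using (product)
open import Data.Nat.ListAction.Properties using (∈⇒∣product)
open import Data.List using ([]; _∷_; length; filter; upTo)
open import Data.List.Membership.Propositional.Properties using (∈-filter⁺; ∈-filter⁻; ∈-upTo⁺)
open import Data.List.Relation.Unary.All as All using (All; []; _∷_)
open import Data.Product using (_,_; proj₂; ∃)
open import Data.Sum using (inj₁; inj₂)
open import Data.Empty using (⊥-elim)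
open import Relation.Nullary using (yes; no; ¬?)
open import Relation.Unary using (Decidable)
open import Relation.Binary.PropositionalEquality using (_≡_; refl; sym; cong; subst)
open import Function using (_∘_)
open import Function.Bundles using (mk⇔)
open import Data.Nat.Solver using (module +-*-Solver)

^-pres-∣ : ∀ {m n} j → m ∣ n → m ^ j ∣ n ^ j
^-pres-∣ zero    m∣n = ∣-refl
^-pres-∣ (suc j) m∣n = *-pres-∣ m∣n (^-pres-∣ j m∣n)

^-monoʳ-∣ : ∀ a {k n} → k ≤ n → a ^ k ∣ a ^ n
^-monoʳ-∣ a {k} {n} k≤n = subst (λ e → a ^ k ∣ a ^ e) (m+[n∸m]≡n k≤n)
  (subst (a ^ k ∣_) (sym (^-distribˡ-+-* a k (n ∸ k))) (m∣m*n (a ^ (n ∸ k))))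

prime∣^⇒prime∣ : ∀ {p} a m → Prime p → p ∣ a ^ m → p ∣ a
prime∣^⇒prime∣ a zero    p-prime p∣1 = ⊥-elim (¬prime[1] (subst Prime (∣1⇒≡1 p∣1) p-prime))
prime∣^⇒prime∣ a (suc m) p-prime p∣aᵐ⁺¹ with euclidsLemma a (a ^ m) p-prime p∣aᵐ⁺¹
... | inj₁ p∣a  = p∣a
... | inj₂ p∣aᵐ = prime∣^⇒prime∣ a m p-prime p∣aᵐ

-- Necessity: if n^j ∣ a^n with j ≥ 1 then n ≠ 0 (as 0 ∤ a^0 = 1) and every
-- prime factor of n, dividing a^n, divides a.
^∣^⇒𝓕 : ∀ {a n j} → 1 ≤ j → n ^ j ∣ a ^ n → 𝓕 a n
^∣^⇒𝓕 {a} {zero}  {suc j} _ 0∣1 with () ← 0∣⇒≡0 0∣1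
^∣^⇒𝓕 {a} {suc n} {suc j} _ d =
  s≤s z≤n , λ p p-prime p∣n → prime∣^⇒prime∣ a (suc n) p-prime (∣-trans p∣n (∣-trans (m∣m*n _) d))

2^length≤product : ∀ {ps} → All Prime ps → 2 ^ length ps ≤ product ps
2^length≤product []                 = ≤-refl
2^length≤product (p-prime ∷ primes) =
  *-mono-≤ (nonTrivial⇒n>1 _ {{prime⇒nonTrivial p-prime}}) (2^length≤product primes)

product∣^length : ∀ {a ps} → All (_∣ a) ps → product ps ∣ a ^ length ps
product∣^length []            = ∣-refl
product∣^length (p∣a ∷ ps∣a) = *-pres-∣ p∣a (product∣^length ps∣a)

-- Every n ∈ 𝓕_a divides a^k for some k with 2^k ≤ n (k = number of prime
-- factors of n counted with multiplicity).
𝓕⇒∣^ : ∀ {a n} → 𝓕 a n → ∃ λ k → (n ∣ a ^ k) × (2 ^ k ≤ n)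
𝓕⇒∣^ {a} {n} (n≥1 , prime∣n⇒prime∣a) =
  length ps , subst (_∣ a ^ length ps) (sym n≡∏ps) (product∣^length ps∣a)
            , subst (2 ^ length ps ≤_) (sym n≡∏ps) (2^length≤product ps-prime)
  where
  open PrimeFactorisation (factorise n {{>-nonZero n≥1}})
    renaming (factors to ps; isFactorisation to n≡∏ps; factorsPrime to ps-prime)
  ps∣a : All (_∣ a) ps
  ps∣a = All.tabulate λ {p} p∈ps →
    prime∣n⇒prime∣a p (All.lookup ps-prime p∈ps) (subst (p ∣_) (sym n≡∏ps) (∈⇒∣product p∈ps))

ExponentBound : ℕ → ℕ → Set
ExponentBound j n = ∀ k → 2 ^ k ≤ n → j * k ≤ n

𝓕⇒^∣^ : ∀ {a n j} → 𝓕 a n → ExponentBound j n → n ^ j ∣ a ^ n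
𝓕⇒^∣^ {a} {n} {j} n∈𝓕 bound with 𝓕⇒∣^ n∈𝓕
... | k , n∣aᵏ , 2ᵏ≤n = begin
  n ^ j        ∣⟨ ^-pres-∣ j n∣aᵏ ⟩
  (a ^ k) ^ j  ≡⟨ ^-*-assoc a k j ⟩
  a ^ (k * j)  ∣⟨ ^-monoʳ-∣ a (≤-trans (≤-reflexive (*-comm k j)) (bound k 2ᵏ≤n)) ⟩
  a ^ n        ∎
  where open ∣-Reasoning

2*k≤2^k : ∀ k → 2 * k ≤ 2 ^ k
2*k≤2^k zero              = z≤n
2*k≤2^k (suc zero)        = ≤-refl
2*k≤2^k (suc k@(suc _)) = begin
  2 * suc k            ≡⟨ *-suc 2 k ⟩
  2 + 2 * k            ≤⟨ +-mono-≤ (^-monoʳ-≤ 2 {1} {k} (s≤s z≤n)) (2*k≤2^k k) ⟩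
  2 ^ k + 2 ^ k        ≡⟨ cong (2 ^ k +_) (sym (+-identityʳ (2 ^ k))) ⟩
  2 * 2 ^ k            ∎
  where open ≤-Reasoning

-- (m+1)² ≤ 2m² for m ≥ 3, written with m = 3 + t:
-- 2(3+t)² = (4+t)² + (2 + 4t + t²).
next-square≤double-square : ∀ t → (4 + t) * (4 + t) ≤ 2 * ((3 + t) * (3 + t))
next-square≤double-square t =
  subst ((4 + t) * (4 + t) ≤_) (sym (expand t)) (m≤m+n _ (2 + 4 * t + t * t))
  where
  open +-*-Solver
  expand : ∀ t → 2 * ((3 + t) * (3 + t)) ≡ (4 + t) * (4 + t) + (2 + 4 * t + t * t)
  expand = solve 1 (λ t → con 2 :* ((con 3 :+ t) :* (con 3 :+ t))
                        := (con 4 :+ t) :* (con 4 :+ t) :+ (con 2 :+ con 4 :* t :+ t :* t)) refl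

square≤2^ : ∀ {k} → 4 ≤ k → k * k ≤ 2 ^ k
square≤2^ (s≤s (s≤s (s≤s (s≤s {n = t} _)))) = from-four t
  where
  open ≤-Reasoning
  from-four : ∀ t → (4 + t) * (4 + t) ≤ 2 ^ (4 + t)
  from-four zero    = ≤-refl
  from-four (suc t) = begin
    (5 + t) * (5 + t)        ≤⟨ next-square≤double-square (suc t) ⟩
    2 * ((4 + t) * (4 + t))  ≤⟨ *-monoʳ-≤ 2 (from-four t) ⟩
    2 * 2 ^ (4 + t)          ∎

small-exponent-bound : ∀ {j n} → j ≤ 2 → ExponentBound j n
small-exponent-bound {j} j≤2 k 2ᵏ≤n =
  ≤-trans (*-monoˡ-≤ k j≤2) (≤-trans (2*k≤2^k k) 2ᵏ≤n)

-- For any j the exponent bound holds once n ≥ j(j+4): small k give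
-- j·k ≤ j(j+4), and k ≥ j+4 give j·k ≤ k² ≤ 2^k.
large-n-bound : ∀ {j n} → j * (j + 4) ≤ n → ExponentBound j n
large-n-bound {j} {n} N≤n k 2ᵏ≤n with k <? j + 4
... | yes k<j+4 = ≤-trans (*-monoʳ-≤ j (<⇒≤ k<j+4)) N≤n
... | no  k≮j+4 = begin
  j * k  ≤⟨ *-monoˡ-≤ k (≤-trans (m≤m+n j 4) j+4≤k) ⟩
  k * k  ≤⟨ square≤2^ (≤-trans (m≤n+m 4 j) j+4≤k) ⟩
  2 ^ k  ≤⟨ 2ᵏ≤n ⟩
  n      ∎
  where
  open ≤-Reasoning
  j+4≤k : j + 4 ≤ k
  j+4≤k = ≮⇒≥ k≮j+4

finitely-many-exceptions : ∀ {P Q : ℕ → Set} → Decidable P → (∀ {n} → P n → Q n) →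
  ∀ N → (∀ {n} → N ≤ n → Q n → P n) → Σ (List ℕ) λ S → ∀ n → P n ⇔ (Q n × n ∉ S)
finitely-many-exceptions {P} {Q} P? P⇒Q N eventually = S , λ n → mk⇔ (forward n) (backward n)
  where
  S : List ℕ
  S = filter (¬? ∘ P?) (upTo N)
  forward : ∀ n → P n → Q n × n ∉ S
  forward n p = P⇒Q p , λ n∈S → proj₂ (∈-filter⁻ (¬? ∘ P?) {xs = upTo N} n∈S) p
  backward : ∀ n → Q n × n ∉ S → P n
  backward n (q , n∉S) with P? n | n <? N
  ... | yes p | _       = p
  ... | no ¬p | yes n<N = ⊥-elim (n∉S (∈-filter⁺ (¬? ∘ P?) (∈-upTo⁺ n<N) ¬p))
  ... | no _  | no n≮N  = eventually (≮⇒≥ n≮N) q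

small-exponent : ∀ {a n j} → 1 ≤ j → j ≤ 2 → (n ^ j ∣ a ^ n) ⇔ 𝓕 a n
small-exponent {j = j} 1≤j j≤2 =
  mk⇔ (^∣^⇒𝓕 1≤j) (λ n∈𝓕 → 𝓕⇒^∣^ {j = j} n∈𝓕 (small-exponent-bound {j} j≤2))

any-exponent : ∀ a {j} → 1 ≤ j →
  Σ (List ℕ) λ S → ∀ n → (n ^ j ∣ a ^ n) ⇔ (𝓕 a n × n ∉ S)
any-exponent a {j} 1≤j =
  finitely-many-exceptions (λ n → n ^ j ∣? a ^ n) (^∣^⇒𝓕 1≤j) (j * (j + 4))
    (λ N≤n n∈𝓕 → 𝓕⇒^∣^ {j = j} n∈𝓕 (large-n-bound {j} N≤n))

proposition3 : (a : ℕ) → 1 < a →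
    (∀ n → 1 ≤ n → ((n ∣ a ^ n) ⇔ 𝓕 a n))
    × (∀ n → 1 ≤ n → ((n ^ 2 ∣ a ^ n) ⇔ 𝓕 a n))
    × (∀ j → 3 ≤ j → Σ (List ℕ) λ S → (∀ n → 1 ≤ n → ((n ^ j ∣ a ^ n) ⇔ (𝓕 a n × n ∉ S))))
proposition3 a _ = exponent-one , exponent-two , exponent-≥3
  where
  exponent-one : ∀ n → 1 ≤ n → (n ∣ a ^ n) ⇔ 𝓕 a n
  exponent-one n _ =
    subst (λ m → (m ∣ a ^ n) ⇔ 𝓕 a n) (^-identityʳ n) (small-exponent (s≤s z≤n) (s≤s z≤n))
  exponent-two : ∀ n → 1 ≤ n → (n ^ 2 ∣ a ^ n) ⇔ 𝓕 a n
  exponent-two n _ = small-exponent (s≤s z≤n) ≤-refl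
  exponent-≥3 : ∀ j → 3 ≤ j → Σ (List ℕ) λ S → ∀ n → 1 ≤ n → (n ^ j ∣ a ^ n) ⇔ (𝓕 a n × n ∉ S)
  exponent-≥3 j 3≤j with any-exponent a (≤-trans (s≤s z≤n) 3≤j)
  ... | S , characterisation = S , λ n _ → characterisation n
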